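{- Let $G\le\mathrm{Sym}(\mathbb{N})$ be a countable cofinitary group and $H$ a countable group. Then there exist permutations $\vec f=\langle f_n : n\in\mathbb{N}\rangle$ in $\mathrm{Sym}(\mathbb{N})$ such that the subgroup generated by $\vec f$ is isomorphic to $H$ and the subgroup $\langle G,\vec f\rangle$ generated by $G$ together with $\vec f$ is cofinitary.
   Context: $\mathrm{Sym}(\mathbb{N})$ is the group of bijections of $\mathbb{N}$ under composition. A permutation is cofinitary if it is the identity or has only finitely many fixed points; a subgroup is cofinitary if all its elements are cofinitary. -}

module Defs where

open import Level using (0ℓ)
open import Data.Nat using (ℕ; _≤_)
open import Data.Product using (Σ; ∃; _×_; _,_)
open import Data.Sum using (_⊎_)
open import Relation.Nullary using (¬_)
open import Relation.Binary.PropositionalEquality using (_≡_)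
open import Function.Bundles using (_↔_; Inverse)
open import Function.Construct.Composition using (_↔-∘_)
open import Function.Construct.Symmetry using (↔-sym)
open import Function.Construct.Identity using (↔-id)
open import Algebra.Bundles using (Group)

Sym : Set
Sym = ℕ ↔ ℕ

app : Sym → ℕ → ℕ
app σ = Inverse.to σ

_≈ₚ_ : Sym → Sym → Set
σ ≈ₚ τ = ∀ x → app σ x ≡ app τ x

idₚ : Sym
idₚ = ↔-id ℕ

-- composition: (σ ∘ₚ τ) x = σ (τ x)
_∘ₚ_ : Sym → Sym → Sym
σ ∘ₚ τ = σ ↔-∘ τ

_⁻¹ₚ : Sym → Sym
σ ⁻¹ₚ = ↔-sym σ

IsIdentity : Sym → Set
IsIdentity σ = ∀ x → app σ x ≡ x

FinitelyManyFixedPoints : Sym → Set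
FinitelyManyFixedPoints σ = ∃ λ N → ∀ x → N ≤ x → ¬ (app σ x ≡ x)

Cofinitary : Sym → Set
Cofinitary σ = IsIdentity σ ⊎ FinitelyManyFixedPoints σ

SymSubset : Set₁
SymSubset = Sym → Set

record IsSubgroup (G : SymSubset) : Set where
  field
    respects : ∀ {σ τ} → σ ≈ₚ τ → G σ → G τ
    has-id   : G idₚ
    closed-∘ : ∀ {σ τ} → G σ → G τ → G (σ ∘ₚ τ)
    closed-⁻¹ : ∀ {σ} → G σ → G (σ ⁻¹ₚ)

IsCofinitarySubset : SymSubset → Set
IsCofinitarySubset G = ∀ σ → G σ → Cofinitary σ

IsCountableSubset : SymSubset → Set
IsCountableSubset G =
  Σ (ℕ → Sym) λ e → (∀ n → G (e n)) × (∀ σ → G σ → ∃ λ n → e n ≈ₚ σ)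

data Word (I : Set) : Set where
  ε    : Word I
  gen  : I → Word I
  _·_  : Word I → Word I → Word I
  inv  : Word I → Word I

eval : {I : Set} → (I → Sym) → Word I → Sym
eval s ε       = idₚ
eval s (gen i) = s i
eval s (u · v) = eval s u ∘ₚ eval s v
eval s (inv u) = (eval s u) ⁻¹ₚ

Generated : {I : Set} → (I → Sym) → SymSubset
Generated s σ = ∃ λ w → eval s w ≈ₚ σ

GeneratedWith : SymSubset → (ℕ → Sym) → SymSubset
GeneratedWith G f = Generated {I = Σ Sym G ⊎ ℕ} gens
  where
  gens : Σ Sym G ⊎ ℕ → Sym
  gens (Data.Sum.inj₁ (σ , _)) = σ
  gens (Data.Sum.inj₂ n) = f n

IsCountableGroup : Group 0ℓ 0ℓ → Set
IsCountableGroup H = Σ (ℕ → Carrier) λ e → ∀ h → ∃ λ n → e n ≈ h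
  where open Group H

IsomorphicTo : SymSubset → Group 0ℓ 0ℓ → Set
IsomorphicTo S H =
  Σ (Carrier → Sym) λ ψ →
      (∀ {a b} → a ≈ b → ψ a ≈ₚ ψ b)
    × (∀ a b → ψ (a ∙ b) ≈ₚ (ψ a ∘ₚ ψ b))
    × (∀ {a b} → ψ a ≈ₚ ψ b → a ≈ b)
    × (∀ a → S (ψ a))
    × (∀ σ → S σ → ∃ λ a → ψ a ≈ₚ σ)
  where open Group H

module Submission where

-- H acts
-- freely on the set of points H × ℕ (countably many copies of its left regular
-- action).  We build, by a back-and-forth construction, a bijection
-- π : H × ℕ → ℕ, and let h ∈ H act on ℕ by Ψ h = π ∘ (h ·) ∘ π⁻¹.  Then Ψ is
-- an embedding of H into Sym(ℕ), so f n = Ψ (hₙ) (for an enumeration hₙ of H)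
-- generates a copy of H.  The values of π are chosen "fresh": at stage s the
-- new value avoids everything that the first s elements of G can produce from
-- the current finite part of π, and lies beyond their (finitely many) fixed
-- points.  Consequently a fixed point y of a cyclically reduced word
-- g₁ Ψ(h₁) ⋯ gₖ Ψ(hₖ) (gᵢ ≠ 1, hᵢ ≠ 1) is already witnessed by a closed path in
-- a fixed finite stage of π, which bounds y.  Every element of ⟨G, f⟩ is
-- conjugate to such a word, to an element of G or to some Ψ h, hence cofinitary.

open import Defs
open import Level using (0ℓ)
open import Data.Nat using (ℕ; zero; suc; _+_; _*_; _≤_; _<_; _≤?_; z≤n; s≤s; _⊔_)
open import Data.Nat.Properties
open import Data.Nat.Induction using (<-rec)
open import Data.Product using (Σ; ∃; _×_; _,_; proj₁; proj₂)
open import Data.Sum using (_⊎_; inj₁; inj₂)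
open import Data.Unit using (⊤; tt)
open import Data.Empty using (⊥; ⊥-elim)
open import Data.List using (List; []; _∷_; _++_; length)
open import Data.List.Properties using (length-++)
open import Data.List.Relation.Unary.All as All using (All; []; _∷_)
open import Data.List.Relation.Unary.Any using (here; there)
open import Data.List.Membership.Propositional using (_∈_)
open import Relation.Binary.PropositionalEquality
  using (_≡_; refl; sym; trans; cong; subst; subst₂; module ≡-Reasoning)
open import Relation.Binary.Bundles using (Setoid)
open import Relation.Binary.Definitions using (tri<; tri≈; tri>)
open import Relation.Nullary using (¬_; Dec; yes; no)
open import Algebra.Bundles using (Group)
open import Axiom.ExcludedMiddle using (ExcludedMiddle)
open import Function.Bundles using (Inverse; mk↔ₛ′)

nextPair : ℕ × ℕ → ℕ × ℕ
nextPair (a , zero)  = zero , suc a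
nextPair (a , suc b) = suc a , b

unpair : ℕ → ℕ × ℕ
unpair zero    = zero , zero
unpair (suc k) = nextPair (unpair k)

unpair-visits : ∀ d a b → a + b ≡ d → ∃ λ k → unpair k ≡ (a , b)
unpair-visits d zero zero _ = zero , refl
unpair-visits .(suc b) zero (suc b) refl with unpair-visits b b zero (+-identityʳ b)
... | k , visit = suc k , cong nextPair visit
unpair-visits d (suc a) b a+b≡d with unpair-visits d a (suc b) (trans (+-suc a b) a+b≡d)
... | k , visit = suc k , cong nextPair visit

unpair-surjective : ∀ x → ∃ λ k → unpair k ≡ x
unpair-surjective (a , b) = unpair-visits (a + b) a b refl

sumOver : {A : Set} → (A → ℕ) → List A → ℕ
sumOver F []       = 0
sumOver F (x ∷ xs) = F x + sumOver F xs

term≤sumOver : {A : Set} (F : A → ℕ) {x : A} {xs : List A} → x ∈ xs → F x ≤ sumOver F xs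
term≤sumOver F (here refl) = m≤m+n _ _
term≤sumOver F {xs = y ∷ ys} (there x∈ys) = ≤-trans (term≤sumOver F x∈ys) (m≤n+m _ (F y))

sumBelow : (ℕ → ℕ) → ℕ → ℕ
sumBelow F zero    = 0
sumBelow F (suc n) = F n + sumBelow F n

term≤sumBelow : (F : ℕ → ℕ) {k n : ℕ} → k < n → F k ≤ sumBelow F n
term≤sumBelow F {k} {suc n} (s≤s k≤n) with m≤n⇒m<n∨m≡n k≤n
... | inj₁ k<n  = ≤-trans (term≤sumBelow F k<n) (m≤n+m _ (F n))
... | inj₂ refl = m≤m+n _ _

app-from : (σ : Sym) (y : ℕ) → app σ (Inverse.from σ y) ≡ y
app-from σ y = Inverse.inverseˡ σ refl

from-app : (σ : Sym) (x : ℕ) → Inverse.from σ (app σ x) ≡ x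
from-app σ x = Inverse.inverseʳ σ refl

∘ₚ-cong : ∀ {σ σ′ τ τ′} → σ ≈ₚ σ′ → τ ≈ₚ τ′ → (σ ∘ₚ τ) ≈ₚ (σ′ ∘ₚ τ′)
∘ₚ-cong {σ} σ≈σ′ τ≈τ′ x = trans (cong (app σ) (τ≈τ′ x)) (σ≈σ′ _)

⁻¹ₚ-cong : ∀ {σ τ} → σ ≈ₚ τ → (σ ⁻¹ₚ) ≈ₚ (τ ⁻¹ₚ)
⁻¹ₚ-cong {σ} {τ} σ≈τ x = begin
  Inverse.from σ x                           ≡⟨ cong (Inverse.from σ) (sym (app-from τ x)) ⟩
  Inverse.from σ (app τ (Inverse.from τ x))  ≡⟨ cong (Inverse.from σ) (sym (σ≈τ _)) ⟩
  Inverse.from σ (app σ (Inverse.from τ x))  ≡⟨ from-app σ _ ⟩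
  Inverse.from τ x                           ∎
  where open ≡-Reasoning

cofinitary-resp : ∀ σ τ → σ ≈ₚ τ → Cofinitary σ → Cofinitary τ
cofinitary-resp σ τ σ≈τ (inj₁ id)           = inj₁ (λ x → trans (sym (σ≈τ x)) (id x))
cofinitary-resp σ τ σ≈τ (inj₂ (N , no-fix)) = inj₂ (N , λ x N≤x fix → no-fix x N≤x (trans (σ≈τ x) fix))

fixBound : (σ : Sym) → Cofinitary σ → ℕ
fixBound σ (inj₁ _)       = 0
fixBound σ (inj₂ (N , _)) = N

fixBound-spec : ∀ σ c → ¬ IsIdentity σ → ∀ x → fixBound σ c ≤ x → ¬ app σ x ≡ x
fixBound-spec σ (inj₁ id)           σ≠1 x _    = ⊥-elim (σ≠1 id)
fixBound-spec σ (inj₂ (N , no-fix)) σ≠1 x N≤x  = no-fix x N≤x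

-- Cofinitarity is invariant under conjugation: u ∘ v = v⁻¹ (v ∘ u) v, so the
-- fixed points of u ∘ v are the v-preimages of those of v ∘ u.
cofinitary-rotate : ∀ u v → Cofinitary (v ∘ₚ u) → Cofinitary (u ∘ₚ v)
cofinitary-rotate u v (inj₁ id) = inj₁ λ x → begin
  app u (app v x)                                      ≡⟨ sym (from-app v _) ⟩
  Inverse.from v (app v (app u (app v x)))             ≡⟨ cong (Inverse.from v) (id (app v x)) ⟩
  Inverse.from v (app v x)                             ≡⟨ from-app v x ⟩
  x                                                    ∎
  where open ≡-Reasoning
cofinitary-rotate u v (inj₂ (N , no-fix)) = inj₂ (suc (sumBelow (Inverse.from v) N) , no-fix-above)
  where
  no-fix-above : ∀ x → suc (sumBelow (Inverse.from v) N) ≤ x → ¬ app u (app v x) ≡ x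
  no-fix-above x large fix with N ≤? app v x
  ... | yes N≤vx = no-fix (app v x) N≤vx (cong (app v) fix)
  ... | no  N≰vx = <⇒≱ large (subst (_≤ sumBelow (Inverse.from v) N) (from-app v x)
                                    (term≤sumBelow (Inverse.from v) (≰⇒> N≰vx)))

module Classical (em : ExcludedMiddle 0ℓ) where

  IsLeast : (ℕ → Set) → ℕ → Set
  IsLeast P r = P r × (∀ k → k < r → ¬ P k)

  least : (P : ℕ → Set) → ∀ n → P n → Σ ℕ (IsLeast P)
  least P = <-rec (λ n → P n → Σ ℕ (IsLeast P)) search
    where
    search : ∀ n → (∀ {m} → m < n → P m → Σ ℕ (IsLeast P)) → P n → Σ ℕ (IsLeast P)
    search n smaller pn with em {Σ ℕ λ k → k < n × P k}
    ... | yes (k , k<n , pk) = smaller k<n pk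
    ... | no none            = n , pn , λ k k<n pk → none (k , k<n , pk)

  least-unique : ∀ {P Q : ℕ → Set} → (∀ {k} → P k → Q k) → (∀ {k} → Q k → P k) →
                 ∀ {r s} → IsLeast P r → IsLeast Q s → r ≡ s
  least-unique P⇒Q Q⇒P {r} {s} (pr , below-r) (qs , below-s) with <-cmp r s
  ... | tri< r<s _ _ = ⊥-elim (below-s r r<s (P⇒Q pr))
  ... | tri≈ _ r≡s _ = r≡s
  ... | tri> _ _ s<r = ⊥-elim (below-r s s<r (Q⇒P qs))

  -- In a setoid enumerated by ℕ the least index of an element is a code that
  -- respects the setoid equality: this turns setoid elements into numbers.
  module CanonicalIndex (S : Setoid 0ℓ 0ℓ) (enum : ℕ → Setoid.Carrier S)
                        (onto : ∀ a → ∃ λ n → Setoid._≈_ S (enum n) a) where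
    open Setoid S using (Carrier; _≈_)

    leastIndex : ∀ a → Σ ℕ (IsLeast λ k → enum k ≈ a)
    leastIndex a = least (λ k → enum k ≈ a) (proj₁ (onto a)) (proj₂ (onto a))

    index : Carrier → ℕ
    index a = proj₁ (leastIndex a)

    index-spec : ∀ a → enum (index a) ≈ a
    index-spec a = proj₁ (proj₂ (leastIndex a))

    index-cong : ∀ {a b} → a ≈ b → index a ≡ index b
    index-cong {a} {b} a≈b =
      least-unique (λ p → Setoid.trans S p a≈b) (λ p → Setoid.trans S p (Setoid.sym S a≈b))
                   (proj₂ (leastIndex a)) (proj₂ (leastIndex b))

-- The free H-set H × ℕ, with H coded by canonical indices: a point (n , m) is
-- the element enumH n in copy m, and it is canonical when n is the index of
-- enumH n.
module FreeAction (em : ExcludedMiddle 0ℓ) (H : Group 0ℓ 0ℓ) (Hcount : IsCountableGroup H) where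
  open Group H using (Carrier; _≈_; _∙_; setoid) renaming (ε to 1ᴴ)
  module ℍ = Group H
  open import Algebra.Properties.Group H using (identityˡ-unique)

  enumH : ℕ → Carrier
  enumH = proj₁ Hcount

  open Classical.CanonicalIndex em setoid enumH (proj₂ Hcount) public
    using (index; index-spec; index-cong)

  index-canonical : ∀ a → index (enumH (index a)) ≡ index a
  index-canonical a = index-cong (index-spec a)

  Point : Set
  Point = ℕ × ℕ

  Canonical : Point → Set
  Canonical (n , m) = index (enumH n) ≡ n

  act : Carrier → Point → Point
  act h (n , m) = index (h ∙ enumH n) , m

  act-canonical : ∀ h x → Canonical (act h x)
  act-canonical h (n , m) = index-canonical (h ∙ enumH n)

  act-cong : ∀ {a b} x → a ≈ b → act a x ≡ act b x
  act-cong (n , m) a≈b = cong (_, m) (index-cong (ℍ.∙-cong a≈b ℍ.refl))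

  act-comp : ∀ a b x → act a (act b x) ≡ act (a ∙ b) x
  act-comp a b (n , m) = cong (_, m) (index-cong
    (ℍ.trans (ℍ.∙-cong ℍ.refl (index-spec (b ∙ enumH n))) (ℍ.sym (ℍ.assoc a b (enumH n)))))

  act-id : ∀ x → Canonical x → act 1ᴴ x ≡ x
  act-id (n , m) canonical = cong (_, m) (trans (index-cong (ℍ.identityˡ (enumH n))) canonical)

  act-free : ∀ h x → act h x ≡ x → h ≈ 1ᴴ
  act-free h (n , m) fixed = identityˡ-unique h (enumH n)
    (ℍ.trans (ℍ.sym (index-spec (h ∙ enumH n))) (ℍ.reflexive (cong (λ x → enumH (proj₁ x)) fixed)))

-- The back-and-forth construction of π : canonical points → ℕ, relative to a
-- sequence enumG of permutations with numbers bound n; the cycle bound below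
-- assumes that bound n exceeds the fixed points of a nontrivial enumG n.
module Construction (em : ExcludedMiddle 0ℓ) (H : Group 0ℓ 0ℓ) (Hcount : IsCountableGroup H)
                    (enumG : ℕ → Sym) (bound : ℕ → ℕ) where
  open Group H using (Carrier; _≈_; _∙_) renaming (ε to 1ᴴ; _⁻¹ to _⁻¹ᴴ)
  open FreeAction em H Hcount

  PMap : Set
  PMap = List (Point × ℕ)

  InMap : PMap → Point → ℕ → Set
  InMap p x y = (x , y) ∈ p

  InDom : Point → PMap → Set
  InDom x p = Σ ℕ (InMap p x)

  InRan : ℕ → PMap → Set
  InRan y p = Σ Point λ x → InMap p x y

  _⊆_ : PMap → PMap → Set
  p ⊆ p′ = ∀ {q} → q ∈ p → q ∈ p′

  freshPoint : PMap → Point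
  freshPoint p = index 1ᴴ , suc (sumOver (λ q → proj₂ (proj₁ q)) p)

  freshPoint-canonical : ∀ p → Canonical (freshPoint p)
  freshPoint-canonical p = index-canonical 1ᴴ

  freshPoint-copy : ∀ {p x y} → (x , y) ∈ p → proj₂ x < proj₂ (freshPoint p)
  freshPoint-copy m = s≤s (term≤sumOver (λ q → proj₂ (proj₁ q)) m)

  freshPoint-∉dom : ∀ p → ¬ InDom (freshPoint p) p
  freshPoint-∉dom p (_ , m) = <-irrefl refl (freshPoint-copy m)

  -- What the n-th permutation must not meet: its fixed-point bound and its
  -- images and preimages of the values of p.
  obstacles : PMap → ℕ → ℕ
  obstacles p n = bound n + (sumOver (λ q → app (enumG n) (proj₂ q)) p
                           + sumOver (λ q → Inverse.from (enumG n) (proj₂ q)) p)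

  freshNum : ℕ → PMap → ℕ
  freshNum s p = suc (sumOver proj₂ p + sumBelow (obstacles p) (suc s))

  obstacles<freshNum : ∀ p {n s} → n ≤ s → obstacles p n < freshNum s p
  obstacles<freshNum p le =
    s≤s (≤-trans (term≤sumBelow (obstacles p) (s≤s le)) (m≤n+m _ (sumOver proj₂ p)))

  freshNum-∉ran : ∀ s p → ¬ InRan (freshNum s p) p
  freshNum-∉ran s p (_ , m) = <-irrefl refl (s≤s (≤-trans (term≤sumOver proj₂ m) (m≤m+n _ _)))

  bound≤freshNum : ∀ {s p n} → n ≤ s → bound n ≤ freshNum s p
  bound≤freshNum {p = p} le = ≤-trans (m≤m+n _ _) (<⇒≤ (obstacles<freshNum p le))

  image<freshNum : ∀ {s p n x y} → n ≤ s → (x , y) ∈ p → app (enumG n) y < freshNum s p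
  image<freshNum {p = p} {n} le m = ≤-<-trans
    (≤-trans (term≤sumOver (λ q → app (enumG n) (proj₂ q)) m) (≤-trans (m≤m+n _ _) (m≤n+m _ (bound n))))
    (obstacles<freshNum p le)

  preimage<freshNum : ∀ {s p n x y} → n ≤ s → (x , y) ∈ p → Inverse.from (enumG n) y < freshNum s p
  preimage<freshNum {p = p} {n} le m = ≤-<-trans
    (≤-trans (term≤sumOver (λ q → Inverse.from (enumG n) (proj₂ q)) m) (≤-trans (m≤n+m _ _) (m≤n+m _ (bound n))))
    (obstacles<freshNum p le)

  NeedsImage : ℕ → PMap → Set
  NeedsImage s p = Canonical (unpair s) × ¬ InDom (unpair s) p

  forthBy : ∀ s p → Dec (NeedsImage s p) → PMap
  forthBy s p (yes _) = (unpair s , freshNum s p) ∷ p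
  forthBy s p (no _)  = p

  forth : ℕ → PMap → PMap
  forth s p = forthBy s p em

  backBy : ∀ s p → Dec (InRan s p) → PMap
  backBy s p (yes _) = p
  backBy s p (no _)  = (freshPoint p , s) ∷ p

  back : ℕ → PMap → PMap
  back s p = backBy s p em

  stage : ℕ → PMap
  stage zero    = []
  stage (suc s) = back s (forth s (stage s))

  forth-⊆ : ∀ s p → p ⊆ forth s p
  forth-⊆ s p = grows em
    where
    grows : (d : Dec (NeedsImage s p)) → p ⊆ forthBy s p d
    grows (yes _) m = there m
    grows (no _)  m = m

  back-⊆ : ∀ s p → p ⊆ back s p
  back-⊆ s p = grows em
    where
    grows : (d : Dec (InRan s p)) → p ⊆ backBy s p d
    grows (yes _) m = m
    grows (no _)  m = there m

  stage-step : ∀ s → stage s ⊆ stage (suc s)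
  stage-step s m = back-⊆ s _ (forth-⊆ s _ m)

  stage-mono : ∀ {s s′} → s ≤ s′ → stage s ⊆ stage s′
  stage-mono {s} {s′} le m with m≤n⇒m<n∨m≡n le
  ... | inj₂ refl = m
  stage-mono {s} {suc s′} le m | inj₁ (s≤s lt) = stage-step s′ (stage-mono lt m)

  record IsPartialInjection (p : PMap) : Set where
    field
      canonical  : ∀ {x y} → (x , y) ∈ p → Canonical x
      functional : ∀ {x y y′} → (x , y) ∈ p → (x , y′) ∈ p → y ≡ y′
      injective  : ∀ {x x′ y} → (x , y) ∈ p → (x′ , y) ∈ p → x ≡ x′

  extend : ∀ {a b p} → IsPartialInjection p → Canonical a → ¬ InDom a p → ¬ InRan b p →
           IsPartialInjection ((a , b) ∷ p)
  extend {a} {b} {p} inj ca a∉dom b∉ran = record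
    { canonical = canonical′ ; functional = functional′ ; injective = injective′ }
    where
    open IsPartialInjection inj
    canonical′ : ∀ {x y} → (x , y) ∈ ((a , b) ∷ p) → Canonical x
    canonical′ (here refl) = ca
    canonical′ (there m)   = canonical m
    functional′ : ∀ {x y y′} → (x , y) ∈ ((a , b) ∷ p) → (x , y′) ∈ ((a , b) ∷ p) → y ≡ y′
    functional′ (here refl) (here refl) = refl
    functional′ (here refl) (there m′)  = ⊥-elim (a∉dom (_ , m′))
    functional′ (there m)   (here refl) = ⊥-elim (a∉dom (_ , m))
    functional′ (there m)   (there m′)  = functional m m′
    injective′ : ∀ {x x′ y} → (x , y) ∈ ((a , b) ∷ p) → (x′ , y) ∈ ((a , b) ∷ p) → x ≡ x′
    injective′ (here refl) (here refl) = refl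
    injective′ (here refl) (there m′)  = ⊥-elim (b∉ran (_ , m′))
    injective′ (there m)   (here refl) = ⊥-elim (b∉ran (_ , m))
    injective′ (there m)   (there m′)  = injective m m′

  forth-injection : ∀ s p → IsPartialInjection p → IsPartialInjection (forth s p)
  forth-injection s p inj = preserved em
    where
    preserved : (d : Dec (NeedsImage s p)) → IsPartialInjection (forthBy s p d)
    preserved (yes (c , new)) = extend inj c new (freshNum-∉ran s p)
    preserved (no _)          = inj

  back-injection : ∀ s p → IsPartialInjection p → IsPartialInjection (back s p)
  back-injection s p inj = preserved em
    where
    preserved : (d : Dec (InRan s p)) → IsPartialInjection (backBy s p d)
    preserved (yes _)   = inj
    preserved (no new)  = extend inj (freshPoint-canonical p) (freshPoint-∉dom p) new

  stage-injection : ∀ s → IsPartialInjection (stage s)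
  stage-injection zero    = record { canonical = λ () ; functional = λ () ; injective = λ () }
  stage-injection (suc s) = back-injection s _ (forth-injection s _ (stage-injection s))

  dom-covered : ∀ k → Canonical (unpair k) → InDom (unpair k) (stage (suc k))
  dom-covered k c with em {InDom (unpair k) (stage k)}
  ... | yes (y , m) = y , stage-step k m
  ... | no new      = added em
    where
    added : (d : Dec (NeedsImage k (stage k))) → InDom (unpair k) (back k (forthBy k (stage k) d))
    added (yes _)      = _ , back-⊆ k _ (here refl)
    added (no ¬needs)  = ⊥-elim (¬needs (c , new))

  ran-covered : ∀ y → InRan y (stage (suc y))
  ran-covered y = added em
    where
    added : (d : Dec (InRan y (forth y (stage y)))) → InRan y (backBy y (forth y (stage y)) d)
    added (yes r) = r
    added (no _)  = _ , here refl

  -- The stage at which a point is offered to the forth step.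
  code : Point → ℕ
  code x = proj₁ (unpair-surjective x)

  dom-covered′ : ∀ x → Canonical x → InDom x (stage (suc (code x)))
  dom-covered′ x c with unpair-surjective x
  ... | k , refl = dom-covered k c

  -- They
  -- are used only through π-in-stage and π⁻¹-in-stage, so they are kept opaque
  -- (their unfoldings are stuck on classical choices).
  opaque
    πBy : ∀ x → Dec (InDom x (stage (suc (code x)))) → ℕ
    πBy x (yes (y , _)) = y
    πBy x (no _)        = 0

    π : Point → ℕ
    π x = πBy x em

    π-in-stage : ∀ x → Canonical x → (x , π x) ∈ stage (suc (code x))
    π-in-stage x c = chosen em
      where
      chosen : (d : Dec (InDom x (stage (suc (code x))))) → (x , πBy x d) ∈ stage (suc (code x))
      chosen (yes (_ , m)) = m
      chosen (no ∉dom)     = ⊥-elim (∉dom (dom-covered′ x c))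

    π⁻¹ : ℕ → Point
    π⁻¹ y = proj₁ (ran-covered y)

    π⁻¹-in-stage : ∀ y → (π⁻¹ y , y) ∈ stage (suc y)
    π⁻¹-in-stage y = proj₂ (ran-covered y)

  inCommonStage : ∀ {s s′ q q′} → q ∈ stage s → q′ ∈ stage s′ →
                  q ∈ stage (s ⊔ s′) × q′ ∈ stage (s ⊔ s′)
  inCommonStage {s} {s′} m m′ = stage-mono (m≤m⊔n s s′) m , stage-mono (m≤n⊔m s s′) m′

  Graphπ : Point → ℕ → Set
  Graphπ x y = Canonical x × π x ≡ y

  stage→graph : ∀ {s x y} → (x , y) ∈ stage s → Graphπ x y
  stage→graph {s} {x} {y} m = c , sym (IsPartialInjection.functional (stage-injection (s ⊔ suc (code x))) (proj₁ both) (proj₂ both))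
    where
    c : Canonical x
    c = IsPartialInjection.canonical (stage-injection s) m
    both : (x , y) ∈ stage (s ⊔ suc (code x)) × (x , π x) ∈ stage (s ⊔ suc (code x))
    both = inCommonStage {s} {suc (code x)} m (π-in-stage x c)

  graph→stage : ∀ {x y} → Graphπ x y → Σ ℕ λ s → (x , y) ∈ stage s
  graph→stage {x} (c , refl) = _ , π-in-stage x c

  π⁻¹-canonical : ∀ y → Canonical (π⁻¹ y)
  π⁻¹-canonical y = IsPartialInjection.canonical (stage-injection (suc y)) (π⁻¹-in-stage y)

  π-π⁻¹ : ∀ y → π (π⁻¹ y) ≡ y
  π-π⁻¹ y = proj₂ (stage→graph (π⁻¹-in-stage y))

  π⁻¹-π : ∀ x → Canonical x → π⁻¹ (π x) ≡ x
  π⁻¹-π x c = IsPartialInjection.injective (stage-injection (suc (π x) ⊔ suc (code x))) (proj₁ both) (proj₂ both)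
    where
    both : (π⁻¹ (π x) , π x) ∈ stage (suc (π x) ⊔ suc (code x)) × (x , π x) ∈ stage (suc (π x) ⊔ suc (code x))
    both = inCommonStage {suc (π x)} {suc (code x)} (π⁻¹-in-stage (π x)) (π-in-stage x c)

  ρ : Carrier → ℕ → ℕ
  ρ h y = π (act h (π⁻¹ y))

  ρ-comp : ∀ a b y → ρ a (ρ b y) ≡ ρ (a ∙ b) y
  ρ-comp a b y = cong π (trans (cong (act a) (π⁻¹-π _ (act-canonical b (π⁻¹ y)))) (act-comp a b (π⁻¹ y)))

  ρ-id : ∀ y → ρ 1ᴴ y ≡ y
  ρ-id y = trans (cong π (act-id (π⁻¹ y) (π⁻¹-canonical y))) (π-π⁻¹ y)

  ρ-cong : ∀ {a b} y → a ≈ b → ρ a y ≡ ρ b y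
  ρ-cong y a≈b = cong π (act-cong (π⁻¹ y) a≈b)

  ρ-free : ∀ h y → ρ h y ≡ y → h ≈ 1ᴴ
  ρ-free h y fix = act-free h (π⁻¹ y)
    (trans (sym (π⁻¹-π _ (act-canonical h (π⁻¹ y)))) (cong π⁻¹ fix))

  ρ-cancel : ∀ {a b} y → a ∙ b ≈ 1ᴴ → ρ a (ρ b y) ≡ y
  ρ-cancel {a} {b} y ab≈1 = trans (ρ-comp a b y) (trans (ρ-cong y ab≈1) (ρ-id y))

  Ψ : Carrier → Sym
  Ψ h = mk↔ₛ′ (ρ h) (ρ (h ⁻¹ᴴ)) (λ y → ρ-cancel y (Group.inverseʳ H h)) (λ y → ρ-cancel y (Group.inverseˡ H h))

  Letter : Set
  Letter = ℕ × Carrier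

  evalLetters : List Letter → Sym
  evalLetters []            = idₚ
  evalLetters ((n , h) ∷ c) = enumG n ∘ₚ (Ψ h ∘ₚ evalLetters c)

  -- w ↦ z along the letter (n , h), read through a relation R ⊆ Point × ℕ
  -- standing for π or one of its finite stages.
  Step : (Point → ℕ → Set) → Letter → ℕ → ℕ → Set
  Step R (n , h) w z = Σ Point λ x → Σ ℕ λ z′ → R x w × R (act h x) z′ × app (enumG n) z′ ≡ z

  Path : (Point → ℕ → Set) → List Letter → ℕ → ℕ → Set
  Path R []      y z = y ≡ z
  Path R (l ∷ c) y z = Σ ℕ λ w → Path R c y w × Step R l w z

  path-π : ∀ c y → Path Graphπ c y (app (evalLetters c) y)
  path-π []            y = refl
  path-π ((n , h) ∷ c) y =
    w , path-π c y , π⁻¹ w , ρ h w , (π⁻¹-canonical w , π-π⁻¹ w) , (act-canonical h (π⁻¹ w) , refl) , refl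
    where w = app (evalLetters c) y

  path-map : ∀ {R R′ : Point → ℕ → Set} → (∀ {x y} → R x y → R′ x y) →
             ∀ c {y z} → Path R c y z → Path R′ c y z
  path-map R⇒R′ []      path = path
  path-map R⇒R′ (l ∷ c) (w , path , x , z′ , r₁ , r₂ , gz) =
    w , path-map R⇒R′ c path , x , z′ , R⇒R′ r₁ , R⇒R′ r₂ , gz

  -- A path through π uses finitely many pairs, hence lies in a finite stage.
  path-finite : ∀ c {y z} → Path Graphπ c y z → Σ ℕ λ s → Path (InMap (stage s)) c y z
  path-finite []      path = 0 , path
  path-finite (l ∷ c) (w , path , x , z′ , r₁ , r₂ , gz)
    with path-finite c path | graph→stage r₁ | graph→stage r₂
  ... | s , path′ | s₁ , m₁ | s₂ , m₂ =
    s ⊔ (s₁ ⊔ s₂) ,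
    w , path-map (stage-mono (m≤m⊔n s _)) c path′ , x , z′ ,
    stage-mono (≤-trans (m≤m⊔n s₁ s₂) (m≤n⊔m s _)) m₁ ,
    stage-mono (≤-trans (m≤n⊔m s₁ s₂) (m≤n⊔m s _)) m₂ , gz

  path-start : ∀ {R} l c {y z} → Path R (l ∷ c) y z → Σ Point λ x → R x y
  path-start l []       (_ , refl , x , _ , r₁ , _) = x , r₁
  path-start l (l′ ∷ c) (_ , path , _)              = path-start l′ c path

  Admissible : Letter → Set
  Admissible (n , h) = ¬ IsIdentity (enumG n) × ¬ (h ≈ 1ᴴ)

  AdmissibleAt : ℕ → Letter → Set
  AdmissibleAt K l = proj₁ l ≤ K × Admissible l

  admissible-bounded : ∀ c → All Admissible c → Σ ℕ λ K → All (AdmissibleAt K) c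
  admissible-bounded []            []          = 0 , []
  admissible-bounded ((n , h) ∷ c) (ok ∷ oks) with admissible-bounded c oks
  ... | K , oks′ = n ⊔ K , (m≤m⊔n n K , ok) ∷ All.map (λ (n≤K , ok′) → ≤-trans n≤K (m≤n⊔m n K) , ok′) oks′

  -- Adding a pair with a fresh point never creates a path: a letter with h ≠ 1
  -- would have to map the fresh point to itself or to an old point.
  module BackRemoval (p : PMap) (b : ℕ) where
    p′ : PMap
    p′ = (freshPoint p , b) ∷ p

    step-old : ∀ {n h w z} → ¬ (h ≈ 1ᴴ) → Step (InMap p′) (n , h) w z → Step (InMap p) (n , h) w z
    step-old {n} {h} h≠1 (x , z′ , r₁ , r₂ , gz) = x , z′ , old₁ r₁ r₂ , old₂ r₁ r₂ , gz
      where
      fresh-stuck : act h (freshPoint p) ≡ freshPoint p → ⊥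
      fresh-stuck fixed = h≠1 (act-free h (freshPoint p) fixed)
      old₁ : ∀ {w} → (x , w) ∈ p′ → (act h x , z′) ∈ p′ → (x , w) ∈ p
      old₁ (here refl) (here e)   = ⊥-elim (fresh-stuck (cong proj₁ e))
      old₁ (here refl) (there m₂) = ⊥-elim (<-irrefl refl (freshPoint-copy m₂))
      old₁ (there m₁)  _          = m₁
      old₂ : ∀ {w} → (x , w) ∈ p′ → (act h x , z′) ∈ p′ → (act h x , z′) ∈ p
      old₂ (here refl) (here e)   = ⊥-elim (fresh-stuck (cong proj₁ e))
      old₂ (here refl) (there m₂) = ⊥-elim (<-irrefl refl (freshPoint-copy m₂))
      old₂ (there m₁)  (here e)   = ⊥-elim (<-irrefl (cong (λ q → proj₂ (proj₁ q)) e) (freshPoint-copy m₁))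
      old₂ (there m₁)  (there m₂) = m₂

    path-old : ∀ c {y z} → All (λ l → ¬ (proj₂ l ≈ 1ᴴ)) c → Path (InMap p′) c y z → Path (InMap p) c y z
    path-old []            []          path           = path
    path-old ((n , h) ∷ c) (h≠1 ∷ hs)  (w , path , st) = w , path-old c hs path , step-old h≠1 st

  module CycleBound (bound-spec : ∀ n → ¬ IsIdentity (enumG n) → ∀ x → bound n ≤ x → ¬ app (enumG n) x ≡ x) where

    -- Adding a pair with the fresh value b of stage s never creates a closed
    -- path of letters admissible at s: no such letter leads into or out of b.
    module ForthRemoval (s : ℕ) (p : PMap) (a : Point) where
      b : ℕ
      b = freshNum s p

      p′ : PMap
      p′ = (a , b) ∷ p

      old-value : ∀ {z} → InRan z p → ¬ z ≡ b
      old-value r refl = freshNum-∉ran s p r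

      old-pair : ∀ {x w} → (x , w) ∈ p′ → ¬ w ≡ b → (x , w) ∈ p
      old-pair (here refl) w≢b = ⊥-elim (w≢b refl)
      old-pair (there m)   _   = m

      step-avoids-fresh : ∀ {n z z′} → n ≤ s → ¬ IsIdentity (enumG n) →
                          InRan z′ p′ → app (enumG n) z′ ≡ z → InRan z p′ → ¬ z ≡ b × ¬ z′ ≡ b
      step-avoids-fresh {n} n≤s g≠1 (_ , here refl) gz (_ , here refl) =
        ⊥-elim (bound-spec n g≠1 b (bound≤freshNum {s} {p} n≤s) gz)
      step-avoids-fresh {n} {z} n≤s g≠1 (_ , here refl) gz (_ , there m) =
        ⊥-elim (<-irrefl (trans (cong (Inverse.from (enumG n)) (sym gz)) (from-app (enumG n) b))
                         (preimage<freshNum n≤s m))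
      step-avoids-fresh n≤s g≠1 (_ , there m′) gz (_ , here refl) =
        ⊥-elim (<-irrefl gz (image<freshNum n≤s m′))
      step-avoids-fresh n≤s g≠1 (x′ , there m′) gz (x , there m) =
        old-value (x , m) , old-value (x′ , m′)

      path-old : ∀ c {y z} → All (AdmissibleAt s) c → Path (InMap p′) c y z → ¬ y ≡ b → InRan z p′ →
                 Path (InMap p) c y z × ¬ z ≡ b
      path-old []            []  refl y≢b _ = refl , y≢b
      path-old ((n , h) ∷ c) ((n≤s , g≠1 , _) ∷ oks) (w , path , x , z′ , r₁ , r₂ , gz) y≢b z∈ran
        with path-old c oks path y≢b (x , r₁)
      ... | path′ , w≢b with step-avoids-fresh n≤s g≠1 (act h x , r₂) gz z∈ran
      ... | z≢b , z′≢b = (w , path′ , x , z′ , old-pair r₁ w≢b , old-pair r₂ z′≢b , gz) , z≢b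

      closed-path-old : ∀ l c {y} → All (AdmissibleAt s) (l ∷ c) → Path (InMap p′) (l ∷ c) y y →
                        Path (InMap p) (l ∷ c) y y
      closed-path-old (n , h) c {y} oks@((n≤s , g≠1 , _) ∷ _) path@(_ , _ , x , z′ , _ , r₂ , gz) =
        proj₁ (path-old ((n , h) ∷ c) oks path y≢b y∈ran)
        where
        y∈ran : InRan y p′
        y∈ran = path-start (n , h) c path
        y≢b : ¬ y ≡ b
        y≢b = proj₁ (step-avoids-fresh n≤s g≠1 (act h x , r₂) gz y∈ran)

    descend-back : ∀ t c {y z} → All (AdmissibleAt t) c → Path (InMap (stage (suc t))) c y z →
                   Path (InMap (forth t (stage t))) c y z
    descend-back t c oks = removed em
      where
      removed : (d : Dec (InRan t (forth t (stage t)))) → ∀ {y z} →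
                Path (InMap (backBy t (forth t (stage t)) d)) c y z → Path (InMap (forth t (stage t))) c y z
      removed (yes _) path = path
      removed (no _)  path = BackRemoval.path-old (forth t (stage t)) t c (All.map (λ ok → proj₂ (proj₂ ok)) oks) path

    descend-forth : ∀ t l c {y} → All (AdmissibleAt t) (l ∷ c) → Path (InMap (forth t (stage t))) (l ∷ c) y y →
                    Path (InMap (stage t)) (l ∷ c) y y
    descend-forth t l c oks = removed em
      where
      removed : (d : Dec (NeedsImage t (stage t))) → ∀ {y} →
                Path (InMap (forthBy t (stage t) d)) (l ∷ c) y y → Path (InMap (stage t)) (l ∷ c) y y
      removed (yes _) path = ForthRemoval.closed-path-old t (stage t) (unpair t) l c oks path
      removed (no _)  path = path

    descend : ∀ K d l c {y} → All (AdmissibleAt K) (l ∷ c) →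
              Path (InMap (stage (d + K))) (l ∷ c) y y → Path (InMap (stage K)) (l ∷ c) y y
    descend K zero    l c oks path = path
    descend K (suc d) l c oks path =
      descend K d l c oks (descend-forth (d + K) l c oks′ (descend-back (d + K) (l ∷ c) oks′ path))
      where
      oks′ = All.map (λ (n≤K , ok) → ≤-trans n≤K (m≤n+m K d) , ok) oks

    cycle-bound : ∀ K l c → All (AdmissibleAt K) (l ∷ c) → ∀ y → Path Graphπ (l ∷ c) y y →
                  y < suc (sumOver proj₂ (stage K))
    cycle-bound K l c oks y path with path-finite (l ∷ c) path
    ... | s , path-s with path-start l c (descend K s l c oks
                          (path-map (stage-mono (m≤m+n s K)) (l ∷ c) path-s))
    ... | _ , y∈ran = s≤s (term≤sumOver proj₂ y∈ran)

    word-cofinitary : ∀ K l c → All (AdmissibleAt K) (l ∷ c) → FinitelyManyFixedPoints (evalLetters (l ∷ c))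
    word-cofinitary K l c oks = suc (sumOver proj₂ (stage K)) , λ y large fix →
      <⇒≱ (cycle-bound K l c oks y (subst (Path Graphπ (l ∷ c) y) fix (path-π (l ∷ c) y))) large

-- Every element of ⟨G , Ψ(H)⟩ is cofinitary: arbitrary words are reduced to
-- alternating ones and, by conjugation, to the cyclically reduced words of the
-- cycle bound, to elements of G, or to a single Ψ h.
module Reduction (em : ExcludedMiddle 0ℓ)
  (G : SymSubset) (Gsub : IsSubgroup G) (Gcount : IsCountableSubset G) (Gcof : IsCofinitarySubset G)
  (H : Group 0ℓ 0ℓ) (Hcount : IsCountableGroup H) where

  open Group H using (Carrier; _≈_; _∙_) renaming (ε to 1ᴴ; _⁻¹ to _⁻¹ᴴ)

  enumG : ℕ → Sym
  enumG = proj₁ Gcount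

  enumG-in : ∀ n → G (enumG n)
  enumG-in = proj₁ (proj₂ Gcount)

  indexG : ∀ g → G g → Σ ℕ λ n → enumG n ≈ₚ g
  indexG = proj₂ (proj₂ Gcount)

  bound : ℕ → ℕ
  bound n = fixBound (enumG n) (Gcof (enumG n) (enumG-in n))

  open FreeAction em H Hcount using (enumH)
  open Construction em H Hcount enumG bound
  open CycleBound (λ n → fixBound-spec (enumG n) (Gcof (enumG n) (enumG-in n)))

  Syl : Set
  Syl = Σ Sym G ⊎ Carrier

  evS : Syl → Sym
  evS (inj₁ (g , _)) = g
  evS (inj₂ h)       = Ψ h

  evL : List Syl → Sym
  evL []      = idₚ
  evL (s ∷ L) = evS s ∘ₚ evL L

  evL-++ : ∀ A B → evL (A ++ B) ≈ₚ (evL A ∘ₚ evL B)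
  evL-++ []      B x = refl
  evL-++ (s ∷ A) B x = cong (app (evS s)) (evL-++ A B x)

  invS : Syl → Syl
  invS (inj₁ (g , g∈G)) = inj₁ (g ⁻¹ₚ , IsSubgroup.closed-⁻¹ Gsub g∈G)
  invS (inj₂ h)         = inj₂ (h ⁻¹ᴴ)

  invL : List Syl → List Syl
  invL []      = []
  invL (s ∷ L) = invL L ++ (invS s ∷ [])

  evS-invS : ∀ s → evS (invS s) ≈ₚ (evS s ⁻¹ₚ)
  evS-invS (inj₁ _) x = refl
  evS-invS (inj₂ _) x = refl

  evL-invL : ∀ L → evL (invL L) ≈ₚ (evL L ⁻¹ₚ)
  evL-invL []      x = refl
  evL-invL (s ∷ L) x = trans (evL-++ (invL L) (invS s ∷ []) x)
    (trans (evL-invL L _) (cong (Inverse.from (evL L)) (evS-invS s x)))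

  toSyl : Σ Sym G ⊎ ℕ → Syl
  toSyl (inj₁ g) = inj₁ g
  toSyl (inj₂ n) = inj₂ (enumH n)

  toSyls : Word (Σ Sym G ⊎ ℕ) → List Syl
  toSyls ε       = []
  toSyls (gen i) = toSyl i ∷ []
  toSyls (u · v) = toSyls u ++ toSyls v
  toSyls (inv u) = invL (toSyls u)

  toSyls-correct : (gs : Σ Sym G ⊎ ℕ → Sym) → (∀ i → evS (toSyl i) ≈ₚ gs i) →
                   ∀ w → evL (toSyls w) ≈ₚ eval gs w
  toSyls-correct gs ok ε       x = refl
  toSyls-correct gs ok (gen i) x = ok i x
  toSyls-correct gs ok (u · v) x = trans (evL-++ (toSyls u) (toSyls v) x)
    (∘ₚ-cong {evL (toSyls u)} {eval gs u} {evL (toSyls v)} {eval gs v} (toSyls-correct gs ok u) (toSyls-correct gs ok v) x)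
  toSyls-correct gs ok (inv u) x = trans (evL-invL (toSyls u) x)
    (⁻¹ₚ-cong {evL (toSyls u)} {eval gs u} (toSyls-correct gs ok u) x)

  Triv : Syl → Set
  Triv (inj₁ (g , _)) = IsIdentity g
  Triv (inj₂ h)       = h ≈ 1ᴴ

  SameKind : Syl → Syl → Set
  SameKind (inj₁ _) (inj₁ _) = ⊤
  SameKind (inj₂ _) (inj₂ _) = ⊤
  SameKind _        _        = ⊥

  sameKind? : ∀ s t → Dec (SameKind s t)
  sameKind? (inj₁ _) (inj₁ _) = yes tt
  sameKind? (inj₁ _) (inj₂ _) = no λ ()
  sameKind? (inj₂ _) (inj₁ _) = no λ ()
  sameKind? (inj₂ _) (inj₂ _) = yes tt

  Reduced : List Syl → Set
  Reduced []          = ⊤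
  Reduced (s ∷ [])    = ¬ Triv s
  Reduced (s ∷ t ∷ L) = ¬ Triv s × ¬ SameKind s t × Reduced (t ∷ L)

  merge : (s t : Syl) → SameKind s t → Syl
  merge (inj₁ (g , g∈G)) (inj₁ (g′ , g′∈G)) _ = inj₁ (g ∘ₚ g′ , IsSubgroup.closed-∘ Gsub g∈G g′∈G)
  merge (inj₂ h)         (inj₂ h′)          _ = inj₂ (h ∙ h′)

  evS-merge : ∀ s t st → evS (merge s t st) ≈ₚ (evS s ∘ₚ evS t)
  evS-merge (inj₁ _) (inj₁ _)  _ x = refl
  evS-merge (inj₂ h) (inj₂ h′) _ x = sym (ρ-comp h h′ x)

  evS-triv : ∀ s → Triv s → evS s ≈ₚ idₚ
  evS-triv (inj₁ _) id   = id
  evS-triv (inj₂ h) h≈1 x = trans (ρ-cong x h≈1) (ρ-id x)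

  Shorter : List Syl → Set
  Shorter L = Σ (List Syl) λ L′ → length L′ < length L × evL L′ ≈ₚ evL L

  prepend : ∀ s L → ¬ Triv s → Reduced L → Reduced (s ∷ L) ⊎ Shorter (s ∷ L)
  prepend s []      s≠1 _ = inj₁ s≠1
  prepend s (t ∷ L) s≠1 r with sameKind? s t
  ... | yes st = inj₂ (merge s t st ∷ L , ≤-refl , λ x → evS-merge s t st _)
  ... | no ¬st = inj₁ (s≠1 , ¬st , r)

  reduce : ∀ L → Reduced L ⊎ Shorter L
  reduce [] = inj₁ tt
  reduce (s ∷ L) with reduce L
  ... | inj₂ (L′ , shorter , same) = inj₂ (s ∷ L′ , s≤s shorter , λ x → cong (app (evS s)) (same x))
  ... | inj₁ reduced with em {Triv s}
  ...   | yes trivial = inj₂ (L , ≤-refl , λ x → sym (evS-triv s trivial _))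
  ...   | no s≠1      = prepend s L s≠1 reduced

  data Shape (g : Sym) (g∈G : G g) : List Syl → Set where
    lone        : Shape g g∈G []
    alternating : ∀ {rest} l c → All Admissible (l ∷ c) →
                  evL (inj₁ (g , g∈G) ∷ rest) ≈ₚ evalLetters (l ∷ c) → Shape g g∈G rest
    oddLength   : ∀ M g′ g′∈G → Shape g g∈G (M ++ inj₁ (g′ , g′∈G) ∷ [])

  letterOf : ∀ g → G g → Carrier → Letter
  letterOf g g∈G h = proj₁ (indexG g g∈G) , h

  letterOf-admissible : ∀ g g∈G h → ¬ IsIdentity g → ¬ (h ≈ 1ᴴ) → Admissible (letterOf g g∈G h)
  letterOf-admissible g g∈G h g≠1 h≠1 =
    (λ id → g≠1 λ x → trans (sym (proj₂ (indexG g g∈G) x)) (id x)) , h≠1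

  letterOf-eval : ∀ g g∈G h σ τ → σ ≈ₚ τ →
                  (g ∘ₚ (Ψ h ∘ₚ σ)) ≈ₚ (enumG (proj₁ (indexG g g∈G)) ∘ₚ (Ψ h ∘ₚ τ))
  letterOf-eval g g∈G h σ τ σ≈τ x =
    trans (cong (λ y → app g (ρ h y)) (σ≈τ x)) (sym (proj₂ (indexG g g∈G) _))

  shape : ∀ g g∈G rest → Reduced (inj₁ (g , g∈G) ∷ rest) → Shape g g∈G rest
  shape g g∈G []                                   _                        = lone
  shape g g∈G (inj₁ _ ∷ _)                         (_ , different , _)      = ⊥-elim (different tt)
  shape g g∈G (inj₂ h ∷ [])                        (g≠1 , _ , h≠1)          =
    alternating (letterOf g g∈G h) [] (letterOf-admissible g g∈G h g≠1 h≠1 ∷ [])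
                (letterOf-eval g g∈G h idₚ idₚ λ _ → refl)
  shape g g∈G (inj₂ h ∷ inj₂ _ ∷ _)                (_ , _ , _ , different , _) = ⊥-elim (different tt)
  shape g g∈G (inj₂ h ∷ inj₁ (g₂ , g₂∈G) ∷ rest)   (g≠1 , _ , h≠1 , _ , r)
    with shape g₂ g₂∈G rest r
  ... | lone                     = oddLength (inj₂ h ∷ []) g₂ g₂∈G
  ... | alternating l c oks same =
    alternating (letterOf g g∈G h) (l ∷ c) (letterOf-admissible g g∈G h g≠1 h≠1 ∷ oks)
                (letterOf-eval g g∈G h (evL (inj₁ (g₂ , g₂∈G) ∷ rest)) (evalLetters (l ∷ c)) same)
  ... | oddLength M g′ g′∈G      = oddLength (inj₂ h ∷ inj₁ (g₂ , g₂∈G) ∷ M) g′ g′∈G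

  startsInH : List Syl → ℕ
  startsInH (inj₂ _ ∷ _) = 1
  startsInH _            = 0

  μ : List Syl → ℕ
  μ L = 2 * length L + startsInH L

  μ-shorter : ∀ L′ L → length L′ < length L → μ L′ < μ L
  μ-shorter L′ L shorter = begin-strict
    2 * length L′ + startsInH L′  <⟨ +-monoʳ-< (2 * length L′) (startsInH<2 L′) ⟩
    2 * length L′ + 2             ≡⟨ +-comm _ 2 ⟩
    2 + 2 * length L′             ≡⟨ sym (*-suc 2 (length L′)) ⟩
    2 * suc (length L′)           ≤⟨ *-monoʳ-≤ 2 shorter ⟩
    2 * length L                  ≤⟨ m≤m+n _ _ ⟩
    2 * length L + startsInH L    ∎
    where
    open ≤-Reasoning
    startsInH<2 : ∀ L → startsInH L < 2
    startsInH<2 []           = s≤s z≤n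
    startsInH<2 (inj₁ _ ∷ _) = s≤s z≤n
    startsInH<2 (inj₂ _ ∷ _) = s≤s (s≤s z≤n)

  Smaller : List Syl → Set
  Smaller L = ∀ L′ → μ L′ < μ L → Cofinitary (evL L′)

  -- Ψ h ∘ (g ∘ M) is conjugate to g ∘ M ∘ Ψ h, which does not start in H.
  rotate-H : ∀ h g g∈G M → Smaller (inj₂ h ∷ inj₁ (g , g∈G) ∷ M) →
             Cofinitary (evL (inj₂ h ∷ inj₁ (g , g∈G) ∷ M))
  rotate-H h g g∈G M IH = cofinitary-rotate (Ψ h) (evL (inj₁ (g , g∈G) ∷ M))
    (cofinitary-resp (evL rotated) (evL (inj₁ (g , g∈G) ∷ M) ∘ₚ Ψ h)
                     (evL-++ (inj₁ (g , g∈G) ∷ M) (inj₂ h ∷ [])) (IH rotated smaller))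
    where
    rotated : List Syl
    rotated = inj₁ (g , g∈G) ∷ (M ++ inj₂ h ∷ [])
    same-length : length rotated ≡ length (inj₂ h ∷ inj₁ (g , g∈G) ∷ M)
    same-length = cong suc (trans (length-++ M) (+-comm _ 1))
    smaller : μ rotated < μ (inj₂ h ∷ inj₁ (g , g∈G) ∷ M)
    smaller = subst (λ k → 2 * k + 0 < 2 * length (inj₂ h ∷ inj₁ (g , g∈G) ∷ M) + 1) (sym same-length)
                    (+-monoʳ-< (2 * length (inj₂ h ∷ inj₁ (g , g∈G) ∷ M)) (s≤s z≤n))

  -- g ∘ (M ∘ g′) is conjugate to M ∘ (g′ ∘ g), a shorter list.
  rotate-G : ∀ g g∈G M g′ g′∈G → Smaller (inj₁ (g , g∈G) ∷ (M ++ inj₁ (g′ , g′∈G) ∷ [])) →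
             Cofinitary (evL (inj₁ (g , g∈G) ∷ (M ++ inj₁ (g′ , g′∈G) ∷ [])))
  rotate-G g g∈G M g′ g′∈G IH = cofinitary-rotate g (evL (M ++ inj₁ (g′ , g′∈G) ∷ []))
    (cofinitary-resp (evL merged) (evL (M ++ inj₁ (g′ , g′∈G) ∷ []) ∘ₚ g) same (IH merged smaller))
    where
    merged : List Syl
    merged = M ++ inj₁ (g′ ∘ₚ g , IsSubgroup.closed-∘ Gsub g′∈G g∈G) ∷ []
    same : evL merged ≈ₚ (evL (M ++ inj₁ (g′ , g′∈G) ∷ []) ∘ₚ g)
    same x = trans (evL-++ M _ x) (sym (evL-++ M (inj₁ (g′ , g′∈G) ∷ []) (app g x)))
    smaller : μ merged < μ (inj₁ (g , g∈G) ∷ (M ++ inj₁ (g′ , g′∈G) ∷ []))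
    smaller = μ-shorter merged (inj₁ (g , g∈G) ∷ (M ++ inj₁ (g′ , g′∈G) ∷ []))
      (subst₂ _<_ (sym (length-++ M {inj₁ (g′ ∘ₚ g , IsSubgroup.closed-∘ Gsub g′∈G g∈G) ∷ []}))
                  (cong suc (sym (length-++ M {inj₁ (g′ , g′∈G) ∷ []}))) ≤-refl)

  admissible-cofinitary : ∀ l c → All Admissible (l ∷ c) → Cofinitary (evalLetters (l ∷ c))
  admissible-cofinitary l c oks = inj₂ (word-cofinitary (proj₁ bounded) l c (proj₂ bounded))
    where bounded = admissible-bounded (l ∷ c) oks

  reduced-cofinitary : ∀ L → Reduced L → Smaller L → Cofinitary (evL L)
  reduced-cofinitary []                              _   _  = inj₁ λ _ → refl
  reduced-cofinitary (inj₂ h ∷ [])                   h≠1 _  = inj₂ (0 , λ x _ fix → h≠1 (ρ-free h x fix))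
  reduced-cofinitary (inj₂ h ∷ inj₂ _ ∷ _)           (_ , different , _) _ = ⊥-elim (different tt)
  reduced-cofinitary (inj₂ h ∷ inj₁ (g , g∈G) ∷ M)   _   IH = rotate-H h g g∈G M IH
  reduced-cofinitary (inj₁ (g , g∈G) ∷ rest)         r   IH with shape g g∈G rest r
  ... | lone                     = Gcof g g∈G
  ... | alternating l c oks same = cofinitary-resp (evalLetters (l ∷ c)) (evL (inj₁ (g , g∈G) ∷ rest))
                                                   (λ x → sym (same x)) (admissible-cofinitary l c oks)
  ... | oddLength M g′ g′∈G      = rotate-G g g∈G M g′ g′∈G IH

  syllables-cofinitary : ∀ L → Cofinitary (evL L)
  syllables-cofinitary L = below (suc (μ L)) L ≤-refl
    where
    below : ∀ n L → μ L < n → Cofinitary (evL L)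
    below zero    L ()
    below (suc n) L μL<n with reduce L
    ... | inj₂ (L′ , shorter , same) =
      cofinitary-resp (evL L′) (evL L) same (below n L′ (≤-trans (μ-shorter L′ L shorter) (≤-pred μL<n)))
    ... | inj₁ r = reduced-cofinitary L r (λ L′ smaller → below n L′ (≤-trans smaller (≤-pred μL<n)))

  generated-cofinitary : (gs : Σ Sym G ⊎ ℕ → Sym) → (∀ i → evS (toSyl i) ≈ₚ gs i) →
                         IsCofinitarySubset (Generated gs)
  generated-cofinitary gs ok σ (w , w≈σ) =
    cofinitary-resp (evL (toSyls w)) σ (λ x → trans (toSyls-correct gs ok w x) (w≈σ x)) (syllables-cofinitary (toSyls w))

module Embedding (em : ExcludedMiddle 0ℓ) (H : Group 0ℓ 0ℓ) (Hcount : IsCountableGroup H)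
                 (enumG : ℕ → Sym) (bound : ℕ → ℕ) where
  open Group H using (Carrier; _≈_; _∙_) renaming (ε to 1ᴴ; _⁻¹ to _⁻¹ᴴ)
  open import Algebra.Properties.Group H using (x∙y⁻¹≈ε⇒x≈y)
  open FreeAction em H Hcount using (enumH)
  open Construction em H Hcount enumG bound

  generators : ℕ → Sym
  generators n = Ψ (enumH n)

  Ψ-injective : ∀ {a b} → Ψ a ≈ₚ Ψ b → a ≈ b
  Ψ-injective {a} {b} Ψa≈Ψb = x∙y⁻¹≈ε⇒x≈y a b (ρ-free (a ∙ b ⁻¹ᴴ) (ρ b 0) fixes)
    where
    open ≡-Reasoning
    fixes : ρ (a ∙ b ⁻¹ᴴ) (ρ b 0) ≡ ρ b 0
    fixes = begin
      ρ (a ∙ b ⁻¹ᴴ) (ρ b 0)   ≡⟨ sym (ρ-comp a (b ⁻¹ᴴ) _) ⟩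
      ρ a (ρ (b ⁻¹ᴴ) (ρ b 0)) ≡⟨ cong (ρ a) (from-app (Ψ b) 0) ⟩
      ρ a 0                   ≡⟨ Ψa≈Ψb 0 ⟩
      ρ b 0                   ∎

  InImage : Sym → Set
  InImage σ = ∃ λ a → Ψ a ≈ₚ σ

  image-∘ : ∀ σ τ → InImage σ → InImage τ → InImage (σ ∘ₚ τ)
  image-∘ σ τ (a , Ψa≈σ) (b , Ψb≈τ) =
    a ∙ b , λ x → trans (sym (ρ-comp a b x)) (∘ₚ-cong {Ψ a} {σ} {Ψ b} {τ} Ψa≈σ Ψb≈τ x)

  image-⁻¹ : ∀ σ → InImage σ → InImage (σ ⁻¹ₚ)
  image-⁻¹ σ (a , Ψa≈σ) = a ⁻¹ᴴ , ⁻¹ₚ-cong {Ψ a} {σ} Ψa≈σ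

  word-in-image : ∀ w → InImage (eval generators w)
  word-in-image ε       = 1ᴴ , ρ-id
  word-in-image (gen n) = enumH n , λ _ → refl
  word-in-image (u · v) = image-∘ (eval generators u) (eval generators v) (word-in-image u) (word-in-image v)
  word-in-image (inv u) = image-⁻¹ (eval generators u) (word-in-image u)

  Ψ-cong : ∀ {a b} → a ≈ b → Ψ a ≈ₚ Ψ b
  Ψ-cong a≈b x = ρ-cong x a≈b

  Ψ-hom : ∀ a b → Ψ (a ∙ b) ≈ₚ (Ψ a ∘ₚ Ψ b)
  Ψ-hom a b x = sym (ρ-comp a b x)

  Ψ-generated : ∀ a → Generated generators (Ψ a)
  Ψ-generated a = gen (proj₁ (proj₂ Hcount a)) , Ψ-cong (proj₂ (proj₂ Hcount a))

  generated-Ψ : ∀ σ → Generated generators σ → InImage σ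
  generated-Ψ σ (w , w≈σ) = proj₁ (word-in-image w) , λ x → trans (proj₂ (word-in-image w) x) (w≈σ x)

  isomorphic : IsomorphicTo (Generated generators) H
  isomorphic = Ψ , Ψ-cong , Ψ-hom , Ψ-injective , Ψ-generated , generated-Ψ

mainTheorem10 : ExcludedMiddle 0ℓ →
    (G : SymSubset) → IsSubgroup G → IsCountableSubset G → IsCofinitarySubset G →
    (H : Group 0ℓ 0ℓ) → IsCountableGroup H →
    Σ (ℕ → Sym) λ f →
      IsomorphicTo (Generated f) H × IsCofinitarySubset (GeneratedWith G f)
mainTheorem10 em G Gsub Gcount Gcof H Hcount =
  generators , isomorphic , generated-cofinitary _ λ { (inj₁ _) _ → refl ; (inj₂ _) _ → refl }
  where
  open Reduction em G Gsub Gcount Gcof H Hcount using (enumG; bound; generated-cofinitary)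
  open Embedding em H Hcount enumG bound using (generators; isomorphic)
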